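{- Let $\mathbb{S}$ be a semifield of order $q^n$ with centre containing $\mathbb{F}_q$, represented on $\mathbb{F}_{q^n}$. Then $\mathrm{mrk}([\mathbb{S}]) = 1$ if and only if $\mathbb{S}$ is isotopic to the field $\mathbb{F}_{q^n}$.
   Context: A semifield is a finite (not necessarily associative) division algebra with identity. An $n$-dimensional algebra over $\mathbb{F}_q$ is $\mathbb{F}_{q^n}$ with an $\mathbb{F}_q$-bilinear multiplication, written uniquely as $\mathbb{S}(x,y)=\sum_{i,j=0}^{n-1}c_{ij}x^{q^i}y^{q^j}$, $c_{ij}\in\mathbb{F}_{q^n}$; $M(\mathbb{S})\in M_n(\mathbb{F}_{q^n})$ has $(i,j)$-entry $c_{ij}$ and $\mathrm{mrk}(\mathbb{S})=\mathrm{rank}(M(\mathbb{S}))$. Algebras $\mathbb{S},\mathbb{S}'$ on $\mathbb{F}_{q^n}$ are isotopic if there are invertible $\mathbb{F}_q$-linear $F,G,H$ with $\mathbb{S}'(F(x),G(y))=H(\mathbb{S}(x,y))$ for all $x,y$; $[\mathbb{S}]$ is the set of algebras on $\mathbb{F}_{q^n}$ isotopic to $\mathbb{S}$ and $\mathrm{mrk}([\mathbb{S}])=\min\{\mathrm{mrk}(\mathbb{T}):\mathbb{T}\in[\mathbb{S}]\}$. -}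

module Defs where

open import Level using (0ℓ)
open import Data.Nat as ℕ using (ℕ; suc; _≤_)
open import Data.Nat.Primality using (Prime)
open import Data.Fin using (Fin; toℕ)
open import Data.Product using (Σ; ∃; _×_; _,_)
open import Relation.Nullary using (¬_)
open import Relation.Binary.PropositionalEquality using (_≡_)
import Relation.Binary.PropositionalEquality as ≡
open import Function.Bundles using (Inverse)
open import Function.Definitions using (Injective)
open import Algebra.Bundles using (CommutativeRing; Semiring)
import Algebra.Definitions.RawSemiring as RawSemiringDefs

IsPrimePower : ℕ → Set
IsPrimePower q = Σ ℕ λ p → Σ ℕ λ k → Prime p × 1 ≤ k × q ≡ p ℕ.^ k

record FiniteField : Set₁ where
  field
    commRing : CommutativeRing 0ℓ 0ℓ
  open CommutativeRing commRing public
  field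
    0≉1     : ¬ (0# ≈ 1#)
    inverse : ∀ x → ¬ (x ≈ 0#) → ∃ λ y → x * y ≈ 1#
    card    : ℕ
    enum    : Inverse (≡.setoid (Fin card)) setoid

module _ (L : FiniteField) (q : ℕ) where
  open FiniteField L
  open RawSemiringDefs (Semiring.rawSemiring semiring) using (_^_; sum)

  -- the subfield F_q of L = F_{q^n}: fixed points of x ↦ x^q
  InFq : Carrier → Set
  InFq λ′ = (λ′ ^ q) ≈ λ′

  record IsInvLinear (F : Carrier → Carrier) : Set where
    field
      cong     : ∀ {x y} → x ≈ y → F x ≈ F y
      additive : ∀ x y → F (x + y) ≈ F x + F y
      homog    : ∀ c x → InFq c → F (c * x) ≈ c * F x
      injective  : ∀ {x y} → F x ≈ F y → x ≈ y
      surjective : ∀ y → ∃ λ x → F x ≈ y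

  record IsAlgebra (S : Carrier → Carrier → Carrier) : Set where
    field
      cong   : ∀ {x x′ y y′} → x ≈ x′ → y ≈ y′ → S x y ≈ S x′ y′
      addˡ   : ∀ x x′ y → S (x + x′) y ≈ S x y + S x′ y
      addʳ   : ∀ x y y′ → S x (y + y′) ≈ S x y + S x y′
      homogˡ : ∀ c x y → InFq c → S (c * x) y ≈ c * S x y
      homogʳ : ∀ c x y → InFq c → S x (c * y) ≈ c * S x y

  IsSemifield : (Carrier → Carrier → Carrier) → Set
  IsSemifield S = IsAlgebra S
    × (∀ x y → ¬ (x ≈ 0#) → ¬ (y ≈ 0#) → ¬ (S x y ≈ 0#))
    × (∃ λ e → ∀ x → (S e x ≈ x) × (S x e ≈ x))

  Isotopic : (Carrier → Carrier → Carrier) → (Carrier → Carrier → Carrier) → Set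
  Isotopic S′ S = Σ (Carrier → Carrier) λ F → Σ (Carrier → Carrier) λ G →
    Σ (Carrier → Carrier) λ H →
      IsInvLinear F × IsInvLinear G × IsInvLinear H ×
      (∀ x y → S′ (F x) (G y) ≈ H (S x y))

  fieldMul : Carrier → Carrier → Carrier
  fieldMul x y = x * y

  module _ (n : ℕ) where
    Matrix : Set
    Matrix = Fin n → Fin n → Carrier

    evalPoly : Matrix → Carrier → Carrier → Carrier
    evalPoly c x y = sum (λ i → sum (λ j → c i j * (x ^ (q ℕ.^ toℕ i)) * (y ^ (q ℕ.^ toℕ j))))

    Represents : Matrix → (Carrier → Carrier → Carrier) → Set
    Represents c S = ∀ x y → S x y ≈ evalPoly c x y

    RowsIndependent : ∀ {r} → Matrix → (Fin r → Fin n) → Set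
    RowsIndependent {r} c ρ = ∀ (a : Fin r → Carrier) →
      (∀ j → sum (λ i → a i * c (ρ i) j) ≈ 0#) → ∀ i → a i ≈ 0#

    HasRank : Matrix → ℕ → Set
    HasRank c r =
      (Σ (Fin r → Fin n) λ ρ → Injective _≡_ _≡_ ρ × RowsIndependent c ρ) ×
      (∀ (ρ : Fin (suc r) → Fin n) → Injective _≡_ _≡_ ρ → ¬ RowsIndependent c ρ)

    HasMrk : (Carrier → Carrier → Carrier) → ℕ → Set
    HasMrk S r = Σ Matrix λ c → Represents c S × HasRank c r

    HasClassMrk : (Carrier → Carrier → Carrier) → ℕ → Set
    HasClassMrk S r =
      (Σ (Carrier → Carrier → Carrier) λ T → IsAlgebra T × Isotopic T S × HasMrk T r) ×
      (∀ T k → IsAlgebra T → Isotopic T S → HasMrk T k → r ≤ k)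

module Submission where

open import Defs
open import Data.Nat using (ℕ; _≤_; _^_)
open import Relation.Binary.PropositionalEquality using (_≡_)
open import Function.Bundles using (_⇔_)

open import Data.Nat using (zero; suc; z≤n; s≤s)
open import Data.Fin using (Fin; toℕ) renaming (zero to fz; suc to fs)
import Data.Fin.Properties as FinP
open import Data.Product using (Σ; ∃; _×_; _,_; proj₁; proj₂)
open import Data.Empty using (⊥-elim)
open import Relation.Nullary using (¬_; yes; no)
open import Relation.Nullary.Decidable using (via-injection; decidable-stable)
open import Relation.Binary.Definitions using (Decidable)
import Relation.Binary.PropositionalEquality as ≡
open import Function.Bundles using (mk⇔)
open import Function.Definitions using (Injective)
open import Function.Properties.Inverse using (Inverse⇒Injection)
import Function.Construct.Symmetry as Symmetry
open import Algebra.Bundles using (Semiring)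
import Algebra.Definitions.RawSemiring as RawSemiringDefs
import Algebra.Properties.Group as GroupProperties
import Algebra.Properties.CommutativeSemigroup as CommSemigroupProperties
import Algebra.Properties.Semiring.Sum as SumProperties

-- Write algebras on L = F_{q^n} through their coefficient
-- matrices c, so that S(x,y) = Σ_{i,j} c_ij x^{q^i} y^{q^j}.
-- (1) A matrix of rank 0 is zero, and a matrix of rank 1 is an outer
--     product c_ij = μ_i r_j; in the latter case S(x,y) = A(x)·B(y) with
--     A, B the linearised polynomials Σ μ_i x^{q^i} and Σ r_j y^{q^j}.
-- (2) If a unital algebra S with identity e has an isotope T(F x, G y) =
--     H(S(x,y)), then T(F e, G e) = H(e) ≠ 0.  Hence no isotope of S is
--     represented by the zero matrix, i.e. mrk([S]) ≥ 1.
-- (3) If moreover T(x,y) = A(x)·B(y), then T(x,y)·κ = T(x,y₀)·T(x₀,y) with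
--     (x₀,y₀) = (F e, G e) and κ = T(x₀,y₀) ≠ 0, which rewrites as
--     H(S(u,v))·κ = H(u)·H(v); so S is isotopic to the field multiplication.
-- (4) Conversely the field multiplication is represented by the matrix unit
--     E₀₀, which has rank 1.
-- The main theorem combines (1)-(3) for "⇒" and (2), (4) for "⇐".

module SemifieldTheory (L : FiniteField) (q : ℕ) where
  open FiniteField L
  open RawSemiringDefs (Semiring.rawSemiring semiring) using (sum) renaming (_^_ to _^ᴸ_)
  open SumProperties semiring using (sum-cong-≋; sum-replicate-zero; *-distribˡ-sum; *-distribʳ-sum)
  open GroupProperties +-group using (identityʳ-unique; ∙-cancelˡ)
  open CommSemigroupProperties *-commutativeSemigroup using (interchange; x∙yz≈y∙xz; xy∙z≈xz∙y)
  open import Relation.Binary.Reasoning.Setoid setoid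

  -- Equality in L is decidable, since L is in bijection with Fin card.
  _≟_ : Decidable _≈_
  _≟_ = via-injection (Inverse⇒Injection (Symmetry.inverse enum)) FinP._≟_

  *-cancelˡ-nonzero : ∀ {c} → ¬ c ≈ 0# → ∀ {x y} → c * x ≈ c * y → x ≈ y
  *-cancelˡ-nonzero {c} c≉0 {x} {y} cx≈cy = begin
    x             ≈⟨ *-identityˡ x ⟨
    1# * x        ≈⟨ *-congʳ dc≈1 ⟨
    (d * c) * x   ≈⟨ *-assoc d c x ⟩
    d * (c * x)   ≈⟨ *-congˡ cx≈cy ⟩
    d * (c * y)   ≈⟨ *-assoc d c y ⟨
    (d * c) * y   ≈⟨ *-congʳ dc≈1 ⟩
    1# * y        ≈⟨ *-identityˡ y ⟩
    y             ∎
    where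
    d = proj₁ (inverse c c≉0)
    dc≈1 : d * c ≈ 1#
    dc≈1 = trans (*-comm d c) (proj₂ (inverse c c≉0))

  zero-product : ∀ {a c} → ¬ c ≈ 0# → a * c ≈ 0# → a ≈ 0#
  zero-product c≉0 ac≈0 = *-cancelˡ-nonzero c≉0 (trans (*-comm _ _) (trans ac≈0 (sym (zeroʳ _))))

  cross-swap : ∀ a b c d → (a * b) * (c * d) ≈ (a * d) * (c * b)
  cross-swap a b c d =
    trans (interchange a b c d) (trans (*-congˡ (*-comm b d)) (sym (interchange a d c b)))

  regroup : ∀ l r x y → l * r * x * y ≈ (l * x) * (r * y)
  regroup l r x y = trans (*-congʳ (xy∙z≈xz∙y l r x)) (*-assoc (l * x) r y)

  sum-zero : ∀ {m} {f : Fin m → Carrier} → (∀ i → f i ≈ 0#) → sum f ≈ 0#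
  sum-zero {m} f≈0 = trans (sum-cong-≋ f≈0) (sum-replicate-zero m)

  linear-zero : ∀ {F} → IsInvLinear L q F → F 0# ≈ 0#
  linear-zero {F} F-lin = identityʳ-unique (F 0#) (F 0#)
    (trans (sym (IsInvLinear.additive F-lin 0# 0#)) (IsInvLinear.cong F-lin (+-identityʳ 0#)))

  linear-nonzero : ∀ {F} → IsInvLinear L q F → ∀ {x} → ¬ x ≈ 0# → ¬ F x ≈ 0#
  linear-nonzero F-lin x≉0 Fx≈0 =
    x≉0 (IsInvLinear.injective F-lin (trans Fx≈0 (sym (linear-zero F-lin))))

  inv : ∀ {F} → IsInvLinear L q F → Carrier → Carrier
  inv F-lin y = proj₁ (IsInvLinear.surjective F-lin y)

  inv-section : ∀ {F} (F-lin : IsInvLinear L q F) y → F (inv F-lin y) ≈ y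
  inv-section F-lin y = proj₂ (IsInvLinear.surjective F-lin y)

  inv-isInvLinear : ∀ {F} (F-lin : IsInvLinear L q F) → IsInvLinear L q (inv F-lin)
  inv-isInvLinear {F} F-lin = record
    { cong       = λ {x} {y} x≈y → F-inj (trans (sec x) (trans x≈y (sym (sec y))))
    ; additive   = λ x y → F-inj (trans (sec (x + y))
        (trans (+-cong (sym (sec x)) (sym (sec y))) (sym (IsInvLinear.additive F-lin _ _))))
    ; homog      = λ c x c∈Fq → F-inj (trans (sec (c * x))
        (trans (*-congˡ (sym (sec x))) (sym (IsInvLinear.homog F-lin c _ c∈Fq))))
    ; injective  = λ {x} {y} e → trans (sym (sec x)) (trans (IsInvLinear.cong F-lin e) (sec y))
    ; surjective = λ y → F y , F-inj (sec (F y))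
    }
    where
    F-inj = IsInvLinear.injective F-lin
    sec = inv-section F-lin

  ∘-isInvLinear : ∀ {F G} → IsInvLinear L q F → IsInvLinear L q G → IsInvLinear L q (λ x → F (G x))
  ∘-isInvLinear {F} {G} F-lin G-lin = record
    { cong       = λ e → IsInvLinear.cong F-lin (IsInvLinear.cong G-lin e)
    ; additive   = λ x y → trans (IsInvLinear.cong F-lin (IsInvLinear.additive G-lin x y))
                                 (IsInvLinear.additive F-lin (G x) (G y))
    ; homog      = λ c x c∈Fq → trans (IsInvLinear.cong F-lin (IsInvLinear.homog G-lin c x c∈Fq))
                                      (IsInvLinear.homog F-lin c (G x) c∈Fq)
    ; injective  = λ e → IsInvLinear.injective G-lin (IsInvLinear.injective F-lin e)
    ; surjective = λ y → inv G-lin (inv F-lin y) ,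
        trans (IsInvLinear.cong F-lin (inv-section G-lin _)) (inv-section F-lin y)
    }

  scaling-isInvLinear : ∀ {k} → ¬ k ≈ 0# → IsInvLinear L q (k *_)
  scaling-isInvLinear {k} k≉0 = record
    { cong       = *-congˡ
    ; additive   = distribˡ k
    ; homog      = λ c x _ → x∙yz≈y∙xz k c x
    ; injective  = *-cancelˡ-nonzero k≉0
    ; surjective = λ y → d * y , trans (sym (*-assoc k d y)) (trans (*-congʳ kd≈1) (*-identityˡ y))
    }
    where
    d = proj₁ (inverse k k≉0)
    kd≈1 = proj₂ (inverse k k≉0)

  -- Isotopy is symmetric (only congruence of the isotope is needed).
  isotopic-sym : ∀ {S T} → IsAlgebra L q T → Isotopic L q T S → Isotopic L q S T
  isotopic-sym {S} {T} T-alg (F , G , H , F-lin , G-lin , H-lin , T≈HS) =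
    inv F-lin , inv G-lin , inv H-lin ,
    inv-isInvLinear F-lin , inv-isInvLinear G-lin , inv-isInvLinear H-lin , S≈H⁻¹T
    where
    S≈H⁻¹T : ∀ x y → S (inv F-lin x) (inv G-lin y) ≈ inv H-lin (T x y)
    S≈H⁻¹T x y = IsInvLinear.injective H-lin (begin
      H (S (inv F-lin x) (inv G-lin y))     ≈⟨ T≈HS _ _ ⟨
      T (F (inv F-lin x)) (G (inv G-lin y)) ≈⟨ IsAlgebra.cong T-alg (inv-section F-lin x) (inv-section G-lin y) ⟩
      T x y                                 ≈⟨ inv-section H-lin (T x y) ⟨
      H (inv H-lin (T x y))                 ∎)

  IsIdentity : (Carrier → Carrier → Carrier) → Carrier → Set
  IsIdentity S e = ∀ x → (S e x ≈ x) × (S x e ≈ x)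

  algebra-zeroˡ : ∀ {S} → IsAlgebra L q S → ∀ y → S 0# y ≈ 0#
  algebra-zeroˡ {S} S-alg y = identityʳ-unique (S 0# y) (S 0# y)
    (trans (sym (IsAlgebra.addˡ S-alg 0# 0# y)) (IsAlgebra.cong S-alg (+-identityʳ 0#) refl))

  identity-nonzero : ∀ {S e} → IsAlgebra L q S → IsIdentity S e → ¬ e ≈ 0#
  identity-nonzero {S} {e} S-alg e-id e≈0 = 0≉1 (sym (begin
    1#      ≈⟨ proj₁ (e-id 1#) ⟨
    S e 1#  ≈⟨ IsAlgebra.cong S-alg e≈0 refl ⟩
    S 0# 1# ≈⟨ algebra-zeroˡ S-alg 1# ⟩
    0#      ∎))

  isotope-nonvanishing : ∀ {S T : Carrier → Carrier → Carrier} {e} {F G H : Carrier → Carrier} →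
    IsAlgebra L q S → IsIdentity S e → IsInvLinear L q H → (∀ x y → T (F x) (G y) ≈ H (S x y)) → ¬ T (F e) (G e) ≈ 0#
  isotope-nonvanishing {e = e} S-alg e-id H-lin T≈HS T≈0 =
    linear-nonzero H-lin (identity-nonzero S-alg e-id)
      (trans (IsInvLinear.cong H-lin (sym (proj₁ (e-id e)))) (trans (sym (T≈HS e e)) T≈0))

  product-isotope⇒field : ∀ {S T e} (A B : Carrier → Carrier) →
    IsAlgebra L q S → IsIdentity S e → Isotopic L q T S →
    (∀ x y → T x y ≈ A x * B y) → Isotopic L q S (fieldMul L q)
  product-isotope⇒field {S} {T} {e} A B S-alg e-id (F , G , H , _ , _ , H-lin , T≈HS) T≈AB =
    inv H-lin , (λ y → inv H-lin (κ * y)) , inv H-lin ,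
    inv-isInvLinear H-lin , ∘-isInvLinear (inv-isInvLinear H-lin) (scaling-isInvLinear κ≉0) ,
    inv-isInvLinear H-lin , S≈H⁻¹mul
    where
    κ = T (F e) (G e)
    κ≉0 : ¬ κ ≈ 0#
    κ≉0 = isotope-nonvanishing {T = T} {F = F} {G = G} S-alg e-id H-lin T≈HS

    cross : ∀ x y → T x y * κ ≈ T x (G e) * T (F e) y
    cross x y = begin
      T x y * κ                                 ≈⟨ *-cong (T≈AB x y) (T≈AB (F e) (G e)) ⟩
      (A x * B y) * (A (F e) * B (G e))         ≈⟨ cross-swap (A x) (B y) (A (F e)) (B (G e)) ⟩
      (A x * B (G e)) * (A (F e) * B y)         ≈⟨ *-cong (T≈AB x (G e)) (T≈AB (F e) y) ⟨
      T x (G e) * T (F e) y                     ∎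

    -- transported through the isotopy: H is multiplicative up to the factor κ
    H-twisted : ∀ u v → H (S u v) * κ ≈ H u * H v
    H-twisted u v = begin
      H (S u v) * κ               ≈⟨ *-congʳ (T≈HS u v) ⟨
      T (F u) (G v) * κ           ≈⟨ cross (F u) (G v) ⟩
      T (F u) (G e) * T (F e) (G v) ≈⟨ *-cong (T≈HS u e) (T≈HS e v) ⟩
      H (S u e) * H (S e v)       ≈⟨ *-cong (IsInvLinear.cong H-lin (proj₂ (e-id u)))
                                            (IsInvLinear.cong H-lin (proj₁ (e-id v))) ⟩
      H u * H v                   ∎

    S≈H⁻¹mul : ∀ x y → S (inv H-lin x) (inv H-lin (κ * y)) ≈ inv H-lin (x * y)
    S≈H⁻¹mul x y = IsInvLinear.injective H-lin (trans (*-cancelˡ-nonzero κ≉0 (begin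
      κ * H (S x′ y′)    ≈⟨ *-comm κ _ ⟩
      H (S x′ y′) * κ    ≈⟨ H-twisted x′ y′ ⟩
      H x′ * H y′        ≈⟨ *-cong (inv-section H-lin x) (inv-section H-lin (κ * y)) ⟩
      x * (κ * y)        ≈⟨ x∙yz≈y∙xz x κ y ⟩
      κ * (x * y)        ∎)) (sym (inv-section H-lin (x * y))))
      where
      x′ = inv H-lin x
      y′ = inv H-lin (κ * y)

  fieldMul-isAlgebra : IsAlgebra L q (fieldMul L q)
  fieldMul-isAlgebra = record
    { cong   = *-cong
    ; addˡ   = λ x x′ y → distribʳ y x x′
    ; addʳ   = distribˡ
    ; homogˡ = λ c x y _ → *-assoc c x y
    ; homogʳ = λ c x y _ → x∙yz≈y∙xz x c y
    }

  module _ {n : ℕ} where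

    linearised : (Fin n → Carrier) → Carrier → Carrier
    linearised a x = sum (λ i → a i * (x ^ᴸ (q ^ toℕ i)))

    evalPoly-outer : ∀ (c : Matrix L q n) (μ r : Fin n → Carrier) → (∀ i j → c i j ≈ μ i * r j) →
      ∀ x y → evalPoly L q n c x y ≈ linearised μ x * linearised r y
    evalPoly-outer c μ r c≈μr x y = begin
      evalPoly L q n c x y
        ≈⟨ sum-cong-≋ (λ i → sum-cong-≋ (λ j →
             trans (*-congʳ (*-congʳ (c≈μr i j))) (regroup (μ i) (r j) _ _))) ⟩
      sum (λ i → sum (λ j → (μ i * X i) * (r j * Y j)))
        ≈⟨ sum-cong-≋ (λ i → sym (*-distribˡ-sum (μ i * X i) (λ j → r j * Y j))) ⟩
      sum (λ i → (μ i * X i) * linearised r y)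
        ≈⟨ *-distribʳ-sum (linearised r y) (λ i → μ i * X i) ⟨
      linearised μ x * linearised r y ∎
      where
      X = λ (i : Fin n) → x ^ᴸ (q ^ toℕ i)
      Y = λ (j : Fin n) → y ^ᴸ (q ^ toℕ j)

    evalPoly-zero : ∀ (c : Matrix L q n) → (∀ i j → c i j ≈ 0#) → ∀ x y → evalPoly L q n c x y ≈ 0#
    evalPoly-zero c c≈0 x y = sum-zero (λ i → sum-zero (λ j →
      trans (*-congʳ (trans (*-congʳ (c≈0 i j)) (zeroˡ _))) (zeroˡ _)))

    oneRow : Fin n → Fin 1 → Fin n
    oneRow i _ = i

    oneRow-injective : ∀ i → Injective _≡_ _≡_ (oneRow i)
    oneRow-injective i {fz} {fz} _ = ≡.refl

    twoRows : Fin n → Fin n → Fin 2 → Fin n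
    twoRows i k fz = i
    twoRows i k (fs _) = k

    twoRows-injective : ∀ {i k} → ¬ i ≡ k → Injective _≡_ _≡_ (twoRows i k)
    twoRows-injective i≢k {fz} {fz} _ = ≡.refl
    twoRows-injective i≢k {fz} {fs fz} i≡k = ⊥-elim (i≢k i≡k)
    twoRows-injective i≢k {fs fz} {fz} k≡i = ⊥-elim (i≢k (≡.sym k≡i))
    twoRows-injective i≢k {fs fz} {fs fz} _ = ≡.refl

    row-independent : ∀ {c : Matrix L q n} {i j} → ¬ c i j ≈ 0# → RowsIndependent L q n c (oneRow i)
    row-independent c≉0 a combo≈0 fz = zero-product c≉0 (trans (sym (+-identityʳ _)) (combo≈0 _))

    zero-row-dependent : ∀ {c : Matrix L q n} {r} (ρ : Fin r → Fin n) (k : Fin r) →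
      (∀ j → c (ρ k) j ≈ 0#) → ¬ RowsIndependent L q n c ρ
    zero-row-dependent {c} ρ k row≈0 indep = 0≉1 (sym (trans (sym δ-at-k) (indep δ combo≈0 k)))
      where
      δ : Fin _ → Carrier
      δ i with i FinP.≟ k
      ... | yes _ = 1#
      ... | no _ = 0#
      δ-at-k : δ k ≈ 1#
      δ-at-k with k FinP.≟ k
      ... | yes _ = refl
      ... | no k≢k = ⊥-elim (k≢k ≡.refl)
      term≈0 : ∀ j i → δ i * c (ρ i) j ≈ 0#
      term≈0 j i with i FinP.≟ k
      ... | yes ≡.refl = trans (*-congˡ (row≈0 j)) (zeroʳ 1#)
      ... | no _ = zeroˡ _
      combo≈0 : ∀ j → sum (λ i → δ i * c (ρ i) j) ≈ 0#
      combo≈0 j = sum-zero (term≈0 j)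

    rank-zero⇒zero : ∀ {c : Matrix L q n} → HasRank L q n c 0 → ∀ i j → c i j ≈ 0#
    rank-zero⇒zero {c} (_ , noRow) i j = decidable-stable (c i j ≟ 0#) (λ c≉0 →
      noRow (oneRow i) (oneRow-injective i) (row-independent {c = c} c≉0))

    two-vectors-independent : ∀ (u v : Fin n → Carrier) {j₀ j μ} → ¬ u j₀ ≈ 0# →
      v j₀ ≈ μ * u j₀ → ¬ v j ≈ μ * u j →
      ∀ a₀ a₁ → (∀ j′ → a₀ * u j′ + a₁ * v j′ ≈ 0#) → (a₀ ≈ 0#) × (a₁ ≈ 0#)
    two-vectors-independent u v {j₀} {j} {μ} u₀≉0 v₀≈μu₀ v≉μu a₀ a₁ combo≈0 = a₀≈0 , a₁≈0
      where
      w = a₀ + a₁ * μ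
      w-expand : ∀ j′ → w * u j′ ≈ a₀ * u j′ + a₁ * (μ * u j′)
      w-expand j′ = trans (distribʳ (u j′) a₀ (a₁ * μ)) (+-congˡ (*-assoc a₁ μ (u j′)))
      w≈0 : w ≈ 0#
      w≈0 = zero-product u₀≉0
        (trans (w-expand j₀) (trans (+-congˡ (*-congˡ (sym v₀≈μu₀))) (combo≈0 j₀)))
      a₁≈0 : a₁ ≈ 0#
      a₁≈0 = decidable-stable (a₁ ≟ 0#) λ a₁≉0 → v≉μu (*-cancelˡ-nonzero a₁≉0
        (∙-cancelˡ (a₀ * u j) _ _ (trans (combo≈0 j)
          (sym (trans (sym (w-expand j)) (trans (*-congʳ w≈0) (zeroˡ _)))))))
      a₀≈0 : a₀ ≈ 0#
      a₀≈0 = begin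
        a₀          ≈⟨ +-identityʳ a₀ ⟨
        a₀ + 0#     ≈⟨ +-congˡ (trans (*-congʳ a₁≈0) (zeroˡ μ)) ⟨
        w           ≈⟨ w≈0 ⟩
        0#          ∎

    -- In a matrix of rank 1 every row is a multiple of the independent row p.
    module RankOne {c : Matrix L q n} (hr : HasRank L q n c 1) where
      p : Fin n
      p = proj₁ (proj₁ hr) fz

      noTwoRows : ∀ (ρ : Fin 2 → Fin n) → Injective _≡_ _≡_ ρ → ¬ RowsIndependent L q n c ρ
      noTwoRows = proj₂ hr

      pivot : ∃ λ j₀ → ¬ c p j₀ ≈ 0#
      pivot = FinP.¬∀⟶∃¬ n _ (λ j → c p j ≟ 0#) λ row≈0 →
        zero-row-dependent {c = c} (proj₁ (proj₁ hr)) fz row≈0 (proj₂ (proj₂ (proj₁ hr)))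

      j₀ = proj₁ pivot
      d = proj₁ (inverse (c p j₀) (proj₂ pivot))

      pivot-inverse : c p j₀ * d ≈ 1#
      pivot-inverse = proj₂ (inverse (c p j₀) (proj₂ pivot))

      -- the proportionality factor of row i, read off in column j₀
      μ : Fin n → Carrier
      μ i = c i j₀ * d

      μ-pivot : ∀ i → c i j₀ ≈ μ i * c p j₀
      μ-pivot i = sym (trans (*-assoc (c i j₀) d (c p j₀))
        (trans (*-congˡ (trans (*-comm d _) pivot-inverse)) (*-identityʳ _)))

      -- for i ≠ p, a failure of proportionality would make rows p and i independent
      proportional : ∀ i j → c i j ≈ μ i * c p j
      proportional i j with i FinP.≟ p
      ... | yes ≡.refl = sym (trans (*-congʳ pivot-inverse) (*-identityˡ (c p j)))
      ... | no i≢p = decidable-stable (c i j ≟ (μ i * c p j)) λ c≉μc →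
            noTwoRows (twoRows p i) (twoRows-injective (λ p≡i → i≢p (≡.sym p≡i)))
              λ a combo≈0 → pair-zero a (two-vectors-independent (c p) (c i) (proj₂ pivot)
                (μ-pivot i) c≉μc (a fz) (a (fs fz))
                (λ j′ → trans (+-congˡ (sym (+-identityʳ _))) (combo≈0 j′)))
        where
        pair-zero : ∀ (a : Fin 2 → Carrier) → (a fz ≈ 0#) × (a (fs fz) ≈ 0#) → ∀ k → a k ≈ 0#
        pair-zero a (a₀≈0 , _) fz = a₀≈0
        pair-zero a (_ , a₁≈0) (fs fz) = a₁≈0

    rank-one⇒outer : ∀ {c : Matrix L q n} → HasRank L q n c 1 →
      Σ (Fin n → Carrier) λ μ → Σ (Fin n → Carrier) λ r → ∀ i j → c i j ≈ μ i * r j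
    rank-one⇒outer {c} hr = μ , c p , proportional
      where open RankOne {c} hr

  δ₀ : ∀ {m} → Fin (suc m) → Carrier
  δ₀ fz = 1#
  δ₀ (fs _) = 0#

  unitMatrix : ∀ m → Matrix L q (suc m)
  unitMatrix m i j = δ₀ i * δ₀ j

  linearised-δ₀ : ∀ {m} x → linearised {suc m} δ₀ x ≈ x
  linearised-δ₀ {m} x = begin
    linearised {suc m} δ₀ x             ≈⟨ +-cong (trans (*-identityˡ _) (*-identityʳ x))
                                                  (sum-zero {m} (λ i → zeroˡ (x ^ᴸ (q ^ toℕ (fs {m} i))))) ⟩
    x + 0#                              ≈⟨ +-identityʳ x ⟩
    x                                   ∎

  unitMatrix-represents : ∀ m → Represents L q (suc m) (unitMatrix m) (fieldMul L q)
  unitMatrix-represents m x y = sym (trans (evalPoly-outer (unitMatrix m) δ₀ δ₀ (λ _ _ → refl) x y)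
    (*-cong (linearised-δ₀ {m} x) (linearised-δ₀ {m} y)))

  unitMatrix-rank : ∀ m → HasRank L q (suc m) (unitMatrix m) 1
  unitMatrix-rank m =
    (oneRow fz , oneRow-injective fz , row-independent {c = unitMatrix m} {fz} {fz} corner≉0) ,
    noTwoRows
    where
    corner≉0 : ¬ 1# * 1# ≈ 0#
    corner≉0 1·1≈0 = 0≉1 (sym (trans (sym (*-identityʳ 1#)) 1·1≈0))
    lower-row-zero : ∀ {i} → ¬ i ≡ fz → ∀ j → unitMatrix m i j ≈ 0#
    lower-row-zero {fz} i≢0 j = ⊥-elim (i≢0 ≡.refl)
    lower-row-zero {fs i} _ j = zeroˡ _
    noTwoRows : ∀ (ρ : Fin 2 → Fin (suc m)) → Injective _≡_ _≡_ ρ →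
      ¬ RowsIndependent L q (suc m) (unitMatrix m) ρ
    noTwoRows ρ ρ-inj with ρ fz FinP.≟ fz
    ... | no ρ₀≢0 = zero-row-dependent {c = unitMatrix m} ρ fz (lower-row-zero ρ₀≢0)
    ... | yes ρ₀≡0 = zero-row-dependent {c = unitMatrix m} ρ (fs fz) (lower-row-zero ρ₁≢0)
      where
      ρ₁≢0 : ¬ ρ (fs fz) ≡ fz
      ρ₁≢0 ρ₁≡0 with ρ-inj (≡.trans ρ₀≡0 (≡.sym ρ₁≡0))
      ... | ()

  module _ {S : Carrier → Carrier → Carrier} {e : Carrier}
           (S-alg : IsAlgebra L q S) (e-id : IsIdentity S e) where

    isotope-mrk-positive : ∀ {n} T k → IsAlgebra L q T → Isotopic L q T S → HasMrk L q n T k → 1 ≤ k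
    isotope-mrk-positive T (suc k) _ _ _ = s≤s z≤n
    isotope-mrk-positive T zero _ (F , G , H , _ , _ , H-lin , T≈HS) (c , rep , hr) =
      ⊥-elim (isotope-nonvanishing {T = T} {F = F} {G = G} S-alg e-id H-lin T≈HS
        (trans (rep _ _) (evalPoly-zero c (rank-zero⇒zero hr) _ _)))

    class-rank-one⇒field : ∀ {n} → HasClassMrk L q n S 1 → Isotopic L q S (fieldMul L q)
    class-rank-one⇒field ((T , _ , T-iso , c , rep , hr) , _) =
      product-isotope⇒field (linearised μ) (linearised r) S-alg e-id T-iso
        (λ x y → trans (rep x y) (evalPoly-outer c μ r c≈μr x y))
      where
      outer = rank-one⇒outer {c = c} hr
      μ = proj₁ outer
      r = proj₁ (proj₂ outer)
      c≈μr = proj₂ (proj₂ outer)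

    field⇒class-rank-one : ∀ m → Isotopic L q S (fieldMul L q) → HasClassMrk L q (suc m) S 1
    field⇒class-rank-one m S-iso =
      (fieldMul L q , fieldMul-isAlgebra , isotopic-sym S-alg S-iso ,
        unitMatrix m , unitMatrix-represents m , unitMatrix-rank m) ,
      isotope-mrk-positive

mainTheorem9 : (q n : ℕ) → IsPrimePower q → 1 ≤ n →
    (L : FiniteField) → FiniteField.card L ≡ q ^ n →
    (S : FiniteField.Carrier L → FiniteField.Carrier L → FiniteField.Carrier L) →
    IsSemifield L q S →
    (HasClassMrk L q n S 1 ⇔ Isotopic L q S (fieldMul L q))
mainTheorem9 q (suc m) _ (s≤s z≤n) L _ S (S-alg , _ , _ , e-id) =
  mk⇔ (class-rank-one⇒field S-alg e-id) (field⇒class-rank-one S-alg e-id m)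
  where open SemifieldTheory L q
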